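{- For $n\ge 0$ and $t\ge 0$ let $f(n,1,t)$ denote the number of permutations $\pi\in S_n$ such that $G_\pi$ has exactly $t$ dominating sets of size one (so $f(n,1,0)=n!-g(n,1)$, where $g(n,1)$ is the number of $\pi\in S_n$ with $\gamma(G_\pi)=1$). Then for $n\ge1$ and $1\le t\le n$, \[ f(n,1,t)=\sum_{k=1}^{n-t+1} f(n-k,1,t-1)\,f(k-1,1,0). \]
   Context: For a permutation $\pi$ of $[n]=\{1,\dots,n\}$ (one-line notation $[\pi(1),\dots,\pi(n)]$), the permutation graph $G_\pi$ has vertex set $[n]$ and an edge between $i<j$ iff $\pi^{ -1}(i)>\pi^{ -1}(j)$. A set $D$ of vertices dominates a graph $G$ if every vertex is in $D$ or adjacent to a vertex of $D$; $\gamma(G)$ is the minimum size of a dominating set. Counts of "permutation graphs on $n$ vertices" with a property are counts of permutations $\pi\in S_n$ whose graph has the property. By convention $0!=1$ and $g(0,1)=0$, so $f(0,1,0)=1$. -}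

module Defs where

open import Data.Nat using (ℕ; zero; suc; _+_; _*_; _∸_)
open import Data.Fin using (Fin; _<_; _≟_)
import Data.Fin.Properties as FinP
open import Data.Fin.Properties using (all?; any?)
open import Data.Vec using (Vec; []; _∷_; lookup)
open import Data.List using (List; []; _∷_; map; concatMap; filter; length; allFin; upTo)
open import Data.Nat.ListAction using (sum)
open import Data.Product using (Σ; ∃; _×_; _,_)
open import Data.Sum using (_⊎_)
open import Relation.Binary.PropositionalEquality using (_≡_)
open import Relation.Nullary using (Dec; ¬_)
open import Relation.Nullary.Decidable using (_×-dec_; _⊎-dec_; _→-dec_)
import Data.Nat.Properties as ℕP

-- A permutation π ∈ S_n in one-line notation: vector whose p-th entry is π(p)
-- (values and positions are taken in Fin n, i.e. {0,…,n-1} standing for [n]).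

allVecs : (n k : ℕ) → List (Vec (Fin n) k)
allVecs n zero    = [] ∷ []
allVecs n (suc k) = concatMap (λ i → map (i ∷_) (allVecs n k)) (allFin n)

IsPerm : ∀ {n} → Vec (Fin n) n → Set
IsPerm {n} v = (p q : Fin n) → lookup v p ≡ lookup v q → p ≡ q

isPerm? : ∀ {n} (v : Vec (Fin n) n) → Dec (IsPerm v)
isPerm? v = all? λ p → all? λ q → (lookup v p ≟ lookup v q) →-dec (p ≟ q)

-- Edge of the permutation graph G_π between vertices (values) x and y:
-- for x < y, an edge iff π⁻¹(x) > π⁻¹(y).
Adj : ∀ {n} → Vec (Fin n) n → Fin n → Fin n → Set
Adj {n} v x y = ∃ λ (p : Fin n) → ∃ λ (q : Fin n) →
  lookup v p ≡ x × lookup v q ≡ y × ((x < y × q < p) ⊎ (y < x × p < q))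

adj? : ∀ {n} (v : Vec (Fin n) n) x y → Dec (Adj v x y)
adj? v x y = any? λ p → any? λ q →
  (lookup v p ≟ x) ×-dec ((lookup v q ≟ y) ×-dec
    (((x FinP.<? y) ×-dec (q FinP.<? p)) ⊎-dec ((y FinP.<? x) ×-dec (p FinP.<? q))))

DominatingVertex : ∀ {n} → Vec (Fin n) n → Fin n → Set
DominatingVertex {n} v x = (y : Fin n) → y ≡ x ⊎ Adj v x y

domVertex? : ∀ {n} (v : Vec (Fin n) n) x → Dec (DominatingVertex v x)
domVertex? v x = all? λ y → (y ≟ x) ⊎-dec adj? v x y

numDom1 : ∀ {n} → Vec (Fin n) n → ℕ
numDom1 {n} v = length (filter (domVertex? v) (allFin n))

f1 : ℕ → ℕ → ℕ
f1 n t = length (filter (λ v → isPerm? v ×-dec (numDom1 v ℕP.≟ t)) (allVecs n n))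

sumFromTo : ℕ → ℕ → (ℕ → ℕ) → ℕ
sumFromTo a b g = sum (map (λ i → g (a + i)) (upTo (suc b ∸ a)))

module Submission where

-- Write π ∈ S_n as its word L = π(1) … π(n) over {0,…,n-1}.  A vertex x of G_π dominates
-- the graph iff x forms an inversion with every other value, i.e. iff x occurs in L after
-- only larger entries and before only smaller ones; call such an entry *dominant*.  So
-- f(n,1,t) counts the duplicate-free words of length n over {0,…,n-1} ("permutation
-- words") with exactly t dominant entries.
--
-- Cutting a permutation word with t ≥ 1 dominant entries at its first dominant entry x
-- gives L = P ++ x ∷ R with P > x > R; here R is a permutation word of size x with t-1
-- dominant entries, and P shifted down by x+1 is one of size a = n-1-x with none.
-- Conversely every such pair glues back, so with k = a+1 the permutation words with t
-- dominant entries are in bijection with the pairs counted by the sum.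

open import Defs
open import Data.Bool using (Bool; true; false; T; if_then_else_; _∧_)
open import Data.Bool.Properties using (T-∧; T-irrelevant)
open import Data.Empty using (⊥; ⊥-elim)
open import Data.Fin as Fin using (Fin; zero; suc; toℕ; fromℕ<; punchOut)
import Data.Fin.Properties as FinP
open import Data.Fin.Permutation using (refute)
open import Data.List as List
  using (List; []; _∷_; _++_; map; filter; length; concatMap; allFin; tabulate; upTo; applyUpTo)
import Data.List.Properties as ListP
open import Data.List.Membership.Propositional.Properties using (∈-lookup)
open import Data.List.Relation.Unary.All as All using (All; []; _∷_; all?)
import Data.List.Relation.Unary.All.Properties as All
open import Data.List.Relation.Unary.AllPairs using ([]; _∷_)
import Data.List.Relation.Unary.AllPairs.Properties as AllPairs
open import Data.List.Relation.Unary.Unique.Propositional using (Unique)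
import Data.List.Relation.Unary.Unique.Propositional.Properties as Unique
open import Data.Nat
  using (ℕ; zero; suc; _+_; _*_; _∸_; _⊓_; _≤_; _<_; z≤n; s≤s; _<?_; _≟_; _≡ᵇ_)
import Data.Nat.Properties as ℕP
open import Algebra.Properties.CommutativeSemigroup ℕP.+-commutativeSemigroup using (x∙yz≈y∙xz)
open import Data.List.Relation.Unary.Unique.DecPropositional _≟_ using (unique?)
open import Data.Nat.ListAction using (sum)
open import Data.Product using (Σ; _×_; _,_; proj₁; proj₂)
open import Data.Product.Function.NonDependent.Propositional using (_×-↔_)
open import Data.Sum using (_⊎_; inj₁; inj₂)
open import Data.Sum.Function.Propositional using (_⊎-↔_)
open import Data.Vec using (Vec; []; _∷_; lookup)
open import Function using (_∘_; id; _↔_; _⇔_; mk↔ₛ′; mk⇔; Equivalence)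
open import Function.Properties.Inverse using (↔-trans; ↔-sym)
open import Relation.Binary.Definitions using (tri<; tri≈; tri>)
open import Relation.Binary.PropositionalEquality
  using (_≡_; _≢_; refl; sym; trans; cong; cong₂; subst; module ≡-Reasoning)
open import Relation.Nullary using (Dec; yes; no; does; ¬_)
open import Relation.Nullary.Decidable
  using (T?; _×-dec_; decidable-stable; dec-true; dec-false; does-⇔)

open ≡-Reasoning

indicator : Bool → ℕ
indicator b = if b then 1 else 0

indicator≤1 : ∀ b → indicator b ≤ 1
indicator≤1 true = s≤s z≤n
indicator≤1 false = z≤n

does⁺ : ∀ {P : Set} (d : Dec P) → P → T (does d)
does⁺ (yes _) _ = _
does⁺ (no ¬p) p = ¬p p

does⁻ : ∀ {P : Set} (d : Dec P) → T (does d) → P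
does⁻ (yes p) _ = p

Card : Set → ℕ → Set
Card A m = Fin m ↔ A

card-unique : ∀ {A m m'} → Card A m → Card A m' → m ≡ m'
card-unique c c' = decidable-stable (_ ≟ _) (λ m≢m' → refute m≢m' (↔-trans c (↔-sym c')))

card-⊎ : ∀ {A B a b} → Card A a → Card B b → Card (A ⊎ B) (a + b)
card-⊎ ca cb = ↔-trans FinP.+↔⊎ (ca ⊎-↔ cb)

card-× : ∀ {A B a b} → Card A a → Card B b → Card (A × B) (a * b)
card-× ca cb = ↔-trans FinP.*↔× (ca ×-↔ cb)

Σ<-suc↔ : ∀ m (X : ℕ → Set) →
  (X 0 ⊎ Σ ℕ (λ a → a < m × X (suc a))) ↔ Σ ℕ (λ a → a < suc m × X a)
Σ<-suc↔ m X = mk↔ₛ′ to from to∘from from∘to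
  where
  to : X 0 ⊎ Σ ℕ (λ a → a < m × X (suc a)) → Σ ℕ (λ a → a < suc m × X a)
  to (inj₁ x) = 0 , s≤s z≤n , x
  to (inj₂ (a , a<m , x)) = suc a , s≤s a<m , x
  from : Σ ℕ (λ a → a < suc m × X a) → X 0 ⊎ Σ ℕ (λ a → a < m × X (suc a))
  from (zero , _ , x) = inj₁ x
  from (suc a , s≤s a<m , x) = inj₂ (a , a<m , x)
  to∘from : ∀ y → to (from y) ≡ y
  to∘from (zero , s≤s z≤n , x) = refl
  to∘from (suc a , s≤s a<m , x) = refl
  from∘to : ∀ y → from (to y) ≡ y
  from∘to (inj₁ x) = refl
  from∘to (inj₂ y) = refl

card-Σ< : ∀ m (X : ℕ → Set) (h : ℕ → ℕ) → (∀ a → Card (X a) (h a)) →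
  Card (Σ ℕ (λ a → a < m × X a)) (sum (applyUpTo h m))
card-Σ< zero X h c = mk↔ₛ′ (λ ()) (λ { (_ , () , _) }) (λ { (_ , () , _) }) (λ ())
card-Σ< (suc m) X h c =
  ↔-trans (card-⊎ (c 0) (card-Σ< m (X ∘ suc) (h ∘ suc) (c ∘ suc))) (Σ<-suc↔ m X)

module _ {A B : Set} {P : B → Set} (P? : (b : B) → Dec (P b)) where

  length-filter-map : ∀ (g : A → B) xs →
    length (filter P? (map g xs)) ≡ length (filter (P? ∘ g) xs)
  length-filter-map g [] = refl
  length-filter-map g (x ∷ xs) with does (P? (g x))
  ... | true = cong suc (length-filter-map g xs)
  ... | false = length-filter-map g xs

  length-filter-concatMap : ∀ (f : A → List B) xs →
    length (filter P? (concatMap f xs)) ≡ sum (map (λ x → length (filter P? (f x))) xs)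
  length-filter-concatMap f [] = refl
  length-filter-concatMap f (x ∷ xs) = begin
    length (filter P? (f x ++ concatMap f xs))
      ≡⟨ cong length (ListP.filter-++ P? (f x) (concatMap f xs)) ⟩
    length (filter P? (f x) ++ filter P? (concatMap f xs))
      ≡⟨ ListP.length-++ (filter P? (f x)) ⟩
    length (filter P? (f x)) + length (filter P? (concatMap f xs))
      ≡⟨ cong (length (filter P? (f x)) +_) (length-filter-concatMap f xs) ⟩
    length (filter P? (f x)) + sum (map (λ x → length (filter P? (f x))) xs) ∎

map-allFin : ∀ {A : Set} m (f : ℕ → A) → map (f ∘ toℕ) (allFin m) ≡ applyUpTo f m
map-allFin m f = trans (ListP.map-tabulate id (f ∘ toℕ)) (tabulate-toℕ m f)
  where
  tabulate-toℕ : ∀ {A : Set} m (f : ℕ → A) → tabulate {n = m} (f ∘ toℕ) ≡ applyUpTo f m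
  tabulate-toℕ zero f = refl
  tabulate-toℕ (suc m) f = cong (f 0 ∷_) (tabulate-toℕ m (f ∘ suc))

count : ℕ → (ℕ → Bool) → ℕ
count zero g = 0
count (suc m) g = indicator (g 0) + count m (g ∘ suc)

count-false : ∀ m → count m (λ _ → false) ≡ 0
count-false zero = refl
count-false (suc m) = count-false m

count-applyUpTo : ∀ m (g : ℕ → Bool) (f : ℕ → ℕ) →
  length (filter (T? ∘ g) (applyUpTo f m)) ≡ count m (g ∘ f)
count-applyUpTo zero g f = refl
count-applyUpTo (suc m) g f with g (f 0)
... | true = cong suc (count-applyUpTo m g (f ∘ suc))
... | false = count-applyUpTo m g (f ∘ suc)

count-allFin : ∀ m (g : ℕ → Bool) → length (filter (T? ∘ g ∘ toℕ) (allFin m)) ≡ count m g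
count-allFin m g = begin
  length (filter (T? ∘ g ∘ toℕ) (allFin m))
    ≡⟨ length-filter-map (T? ∘ g) toℕ (allFin m) ⟨
  length (filter (T? ∘ g) (map toℕ (allFin m)))
    ≡⟨ cong (length ∘ filter (T? ∘ g)) (map-allFin m id) ⟩
  length (filter (T? ∘ g) (upTo m))
    ≡⟨ count-applyUpTo m g id ⟩
  count m g ∎

count-insert : ∀ m y A (g : ℕ → Bool) →
  count m (λ x → if y ≡ᵇ x then A else does (x <? y) ∧ g x)
    ≡ indicator (does (y <? m) ∧ A) + count (m ⊓ y) g
count-insert zero y A g = refl
count-insert (suc m) zero A g = cong (indicator A +_) (count-false m)
count-insert (suc m) (suc y) A g = begin
  indicator (g 0) + count m _
    ≡⟨ cong (indicator (g 0) +_) (count-insert m y A (g ∘ suc)) ⟩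
  indicator (g 0) + (indicator (does (y <? m) ∧ A) + count (m ⊓ y) (g ∘ suc))
    ≡⟨ x∙yz≈y∙xz (indicator (g 0)) (indicator (does (y <? m) ∧ A)) (count (m ⊓ y) (g ∘ suc)) ⟩
  indicator (does (y <? m) ∧ A) + count (suc (m ⊓ y)) g ∎

Word : ℕ → ℕ → List ℕ → Set
Word n k L = All (_< n) L × length L ≡ k

Words : ℕ → ℕ → (List ℕ → Bool) → Set
Words n k q = Σ (List ℕ) (λ L → Word n k L × T (q L))

words-≡ : ∀ {n k q} {w w' : Words n k q} → proj₁ w ≡ proj₁ w' → w ≡ w'
words-≡ {w = L , (a , l) , p} {w' = .L , (a' , l') , p'} refl =
  cong (L ,_) (cong₂ _,_ (cong₂ _,_ (All.irrelevant ℕP.≤-irrelevant a a') (ℕP.≡-irrelevant l l'))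
                         (T-irrelevant p p'))

words-zero : ∀ {n q} (w : Words n 0 q) → proj₁ w ≡ []
words-zero ([] , _) = refl
words-zero (_ ∷ _ , (_ , ()) , _)

words-cons↔ : ∀ n k q → Σ ℕ (λ i → i < n × Words n k (q ∘ (i ∷_))) ↔ Words n (suc k) q
words-cons↔ n k q = mk↔ₛ′ to from to∘from from∘to
  where
  to : Σ ℕ (λ i → i < n × Words n k (q ∘ (i ∷_))) → Words n (suc k) q
  to (i , i<n , L , (L<n , l) , p) = i ∷ L , (i<n ∷ L<n , cong suc l) , p
  from : Words n (suc k) q → Σ ℕ (λ i → i < n × Words n k (q ∘ (i ∷_)))
  from (i ∷ L , (i<n ∷ L<n , l) , p) = i , i<n , L , (L<n , ℕP.suc-injective l) , p
  to∘from : ∀ w → to (from w) ≡ w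
  to∘from (_ ∷ _ , (_ ∷ _ , _) , _) = words-≡ refl
  from∘to : ∀ w → from (to w) ≡ w
  from∘to (i , i<n , _) = cong (λ w → i , i<n , w) (words-≡ refl)

values : ∀ {n k} → Vec (Fin n) k → List ℕ
values [] = []
values (x ∷ v) = toℕ x ∷ values v

-- Filtering the enumeration allVecs n k by a test on the letters counts Words n k q:
-- both sides split by the first letter.
words-card : ∀ n k q → Card (Words n k q) (length (filter (T? ∘ q ∘ values) (allVecs n k)))
words-card n zero q with q [] in q[]
... | true = mk↔ₛ′ (λ _ → [] , ([] , refl) , subst T (sym q[]) _) (λ _ → zero)
                   (λ w → words-≡ (sym (words-zero w))) (λ { zero → refl })
... | false = mk↔ₛ′ (λ ()) (⊥-elim ∘ none) (⊥-elim ∘ none) (λ ())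
  where
  none : Words n 0 q → ⊥
  none w@(L , _ , p) = subst T q[] (subst (T ∘ q) (words-zero w) p)
words-card n (suc k) q =
  subst (Card (Words n (suc k) q)) (sym count-suc)
        (↔-trans (card-Σ< n _ h (λ i → words-card n k (q ∘ (i ∷_)))) (words-cons↔ n k q))
  where
  h : ℕ → ℕ
  h i = length (filter (T? ∘ q ∘ (i ∷_) ∘ values) (allVecs n k))
  count-suc : length (filter (T? ∘ q ∘ values) (allVecs n (suc k))) ≡ sum (applyUpTo h n)
  count-suc = begin
    length (filter (T? ∘ q ∘ values) (allVecs n (suc k)))
      ≡⟨ length-filter-concatMap (T? ∘ q ∘ values) (λ i → map (i ∷_) (allVecs n k)) (allFin n) ⟩
    sum (map (λ i → length (filter (T? ∘ q ∘ values) (map (i ∷_) (allVecs n k)))) (allFin n))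
      ≡⟨ cong sum (ListP.map-cong (λ i → length-filter-map (T? ∘ q ∘ values) (i ∷_) (allVecs n k))
                                  (allFin n)) ⟩
    sum (map (h ∘ toℕ) (allFin n))
      ≡⟨ cong sum (map-allFin n h) ⟩
    sum (applyUpTo h n) ∎

isDominant : List ℕ → ℕ → Bool
isDominant [] x = false
isDominant (y ∷ ys) x =
  if y ≡ᵇ x then does (all? (_<? y) ys) else does (x <? y) ∧ isDominant ys x

DomHead : ℕ → ℕ → List ℕ → Set
DomHead lim y ys = y < lim × All (_< y) ys

domHead? : ∀ lim y ys → Dec (DomHead lim y ys)
domHead? lim y ys = (y <? lim) ×-dec all? (_<? y) ys

-- nDom lim L: the number of entries of L below lim that are smaller than all earlier and
-- larger than all later entries; for a word over {0,…,n-1}, nDom n counts its dominant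
-- entries.
nDom : ℕ → List ℕ → ℕ
nDom lim [] = 0
nDom lim (y ∷ ys) = indicator (does (domHead? lim y ys)) + nDom (lim ⊓ y) ys

count-isDominant : ∀ m L → count m (isDominant L) ≡ nDom m L
count-isDominant m [] = count-false m
count-isDominant m (y ∷ ys) =
  trans (count-insert m y (does (all? (_<? y) ys)) (isDominant ys))
        (cong (indicator (does (domHead? m y ys)) +_) (count-isDominant (m ⊓ y) ys))

all-values⁺ : ∀ {n k} {P : ℕ → Set} (v : Vec (Fin n) k) →
  (∀ q → P (toℕ (lookup v q))) → All P (values v)
all-values⁺ [] _ = []
all-values⁺ (x ∷ v) Pv = Pv zero ∷ all-values⁺ v (Pv ∘ suc)

all-values⁻ : ∀ {n k} {P : ℕ → Set} (v : Vec (Fin n) k) →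
  All P (values v) → ∀ q → P (toℕ (lookup v q))
all-values⁻ (x ∷ v) (Px ∷ _) zero = Px
all-values⁻ (x ∷ v) (_ ∷ Pv) (suc q) = all-values⁻ v Pv q

values-unique⁺ : ∀ {n k} (v : Vec (Fin n) k) →
  (∀ p q → lookup v p ≡ lookup v q → p ≡ q) → Unique (values v)
values-unique⁺ [] _ = []
values-unique⁺ (x ∷ v) inj =
  all-values⁺ v (λ q e → FinP.0≢1+n (inj zero (suc q) (FinP.toℕ-injective e)))
  ∷ values-unique⁺ v (λ p q e → FinP.suc-injective (inj (suc p) (suc q) e))

values-unique⁻ : ∀ {n k} (v : Vec (Fin n) k) →
  Unique (values v) → ∀ p q → lookup v p ≡ lookup v q → p ≡ q
values-unique⁻ (x ∷ v) _ zero zero _ = refl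
values-unique⁻ (x ∷ v) (x∉v ∷ _) zero (suc q) e = ⊥-elim (all-values⁻ v x∉v q (cong toℕ e))
values-unique⁻ (x ∷ v) (x∉v ∷ _) (suc p) zero e = ⊥-elim (all-values⁻ v x∉v p (cong toℕ (sym e)))
values-unique⁻ (x ∷ v) (_ ∷ u) (suc p) (suc q) e = cong suc (values-unique⁻ v u p q e)

≡ᵇ-true : ∀ {m n} → (m ≡ᵇ n) ≡ true → m ≡ n
≡ᵇ-true {m} {n} e = ℕP.≡ᵇ⇒≡ m n (subst T (sym e) _)

≡ᵇ-false : ∀ {m n} → (m ≡ᵇ n) ≡ false → m ≢ n
≡ᵇ-false {m} {n} e m≡n = subst T e (ℕP.≡⇒≡ᵇ m n m≡n)

DominantEntry : ∀ {n k} → Vec (Fin n) k → ℕ → Set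
DominantEntry {k = k} v x = Σ (Fin k) λ p → toℕ (lookup v p) ≡ x
  × (∀ q → q Fin.< p → x < toℕ (lookup v q))
  × (∀ q → p Fin.< q → toℕ (lookup v q) < x)

dominantEntry⇒ : ∀ {n k} (v : Vec (Fin n) k) x → DominantEntry v x → T (isDominant (values v) x)
dominantEntry⇒ (y ∷ v) x (p , at , before , after) with toℕ y ≡ᵇ x in y≟x
dominantEntry⇒ (y ∷ v) x (zero , at , before , after) | true =
  does⁺ (all? (_<? toℕ y) (values v))
        (subst (λ z → All (_< z) (values v)) (sym at) (all-values⁺ v (λ q → after (suc q) (s≤s z≤n))))
dominantEntry⇒ (y ∷ v) x (suc p , at , before , after) | true =
  ⊥-elim (ℕP.<-irrefl (sym (≡ᵇ-true y≟x)) (before zero (s≤s z≤n)))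
dominantEntry⇒ (y ∷ v) x (zero , at , before , after) | false = ⊥-elim (≡ᵇ-false y≟x at)
dominantEntry⇒ (y ∷ v) x (suc p , at , before , after) | false =
  Equivalence.from T-∧ ( does⁺ (x <? toℕ y) (before zero (s≤s z≤n))
                       , dominantEntry⇒ v x (p , at , (λ q q<p → before (suc q) (s≤s q<p))
                                                    , (λ q p<q → after (suc q) (s≤s p<q))))

dominantEntry⇐ : ∀ {n k} (v : Vec (Fin n) k) x → T (isDominant (values v) x) → DominantEntry v x
dominantEntry⇐ (y ∷ v) x t with toℕ y ≡ᵇ x in y≟x
... | true = zero , ≡ᵇ-true y≟x , (λ q ()) ,
  λ { (suc q) _ → subst (toℕ (lookup v q) <_) (≡ᵇ-true y≟x)
                        (all-values⁻ v (does⁻ (all? (_<? toℕ y) (values v)) t) q) }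
... | false with Equivalence.to T-∧ t
... | x<y , rest with dominantEntry⇐ v x rest
... | p , at , before , after =
  suc p , at , (λ { zero _ → does⁻ (x <? toℕ y) x<y ; (suc q) (s≤s q<p) → before q q<p })
             , (λ { (suc q) (s≤s p<q) → after q p<q })

-- An injective vector of length n over Fin n hits every value (pigeonhole principle).
perm-surjective : ∀ {n} (v : Vec (Fin n) n) → IsPerm v → ∀ y → Σ (Fin n) (λ p → lookup v p ≡ y)
perm-surjective {zero} _ _ ()
perm-surjective {suc n} v inj y with FinP.any? (λ p → lookup v p FinP.≟ y)
... | yes hit = hit
... | no miss = ⊥-elim (ℕP.1+n≰n (FinP.injective⇒≤ punched-injective))
  where
  punched : Fin (suc n) → Fin n
  punched p = punchOut {i = y} (λ e → miss (p , sym e))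
  punched-injective : ∀ {p q} → punched p ≡ punched q → p ≡ q
  punched-injective {p} {q} e =
    inj p q (FinP.punchOut-injective {i = y} (λ e → miss (p , sym e)) (λ e → miss (q , sym e)) e)

module _ {n} (v : Vec (Fin n) n) (perm : IsPerm v) where

  adjacent-at : ∀ {p q x y} → lookup v p ≡ x → lookup v q ≡ y → Adj v x y →
    (x Fin.< y × q Fin.< p) ⊎ (y Fin.< x × p Fin.< q)
  adjacent-at {p} {q} atp atq (p' , q' , at₁ , at₂ , inversion)
    with perm p' p (trans at₁ (sym atp)) | perm q' q (trans at₂ (sym atq))
  ... | refl | refl = inversion

  dominating⇒dominant : ∀ x → DominatingVertex v x → DominantEntry v (toℕ x)
  dominating⇒dominant x dom with perm-surjective v perm x
  ... | p , atp = p , cong toℕ atp , before , after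
    where
    before : ∀ q → q Fin.< p → toℕ x < toℕ (lookup v q)
    before q q<p with dom (lookup v q)
    ... | inj₁ vq≡x = ⊥-elim (ℕP.<-irrefl (cong toℕ (perm q p (trans vq≡x (sym atp)))) q<p)
    ... | inj₂ adj with adjacent-at atp refl adj
    ... | inj₁ (x<vq , _) = x<vq
    ... | inj₂ (_ , p<q) = ⊥-elim (ℕP.<-asym p<q q<p)
    after : ∀ q → p Fin.< q → toℕ (lookup v q) < toℕ x
    after q p<q with dom (lookup v q)
    ... | inj₁ vq≡x = ⊥-elim (ℕP.<-irrefl (cong toℕ (perm p q (trans atp (sym vq≡x)))) p<q)
    ... | inj₂ adj with adjacent-at atp refl adj
    ... | inj₁ (_ , q<p) = ⊥-elim (ℕP.<-asym p<q q<p)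
    ... | inj₂ (vq<x , _) = vq<x

  dominant⇒dominating : ∀ x → DominantEntry v (toℕ x) → DominatingVertex v x
  dominant⇒dominating x (p , atp , before , after) y with y FinP.≟ x
  ... | yes y≡x = inj₁ y≡x
  ... | no y≢x with perm-surjective v perm y
  ... | q , atq with ℕP.<-cmp (toℕ q) (toℕ p)
  ... | tri< q<p _ _ =
    inj₂ (p , q , FinP.toℕ-injective atp , atq ,
          inj₁ (subst (λ z → toℕ x < toℕ z) atq (before q q<p) , q<p))
  ... | tri≈ _ q≡p _ =
    ⊥-elim (y≢x (trans (sym atq)
                       (trans (cong (lookup v) (FinP.toℕ-injective q≡p)) (FinP.toℕ-injective atp))))
  ... | tri> _ _ p<q =
    inj₂ (p , q , FinP.toℕ-injective atp , atq ,
          inj₂ (subst (λ z → toℕ z < toℕ x) atq (after q p<q) , p<q))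

  numDom1≡nDom : numDom1 v ≡ nDom n (values v)
  numDom1≡nDom = begin
    length (filter (domVertex? v) (allFin n))
      ≡⟨ cong length (ListP.filter-≐ (domVertex? v) (T? ∘ isDominant (values v) ∘ toℕ)
           ( (λ {x} d → dominantEntry⇒ v (toℕ x) (dominating⇒dominant x d))
           , (λ {x} t → dominant⇒dominating x (dominantEntry⇐ v (toℕ x) t)) ) (allFin n)) ⟩
    length (filter (T? ∘ isDominant (values v) ∘ toℕ) (allFin n))
      ≡⟨ count-allFin n (isDominant (values v)) ⟩
    count n (isDominant (values v))
      ≡⟨ count-isDominant n (values v) ⟩
    nDom n (values v) ∎

permWithDom : ℕ → ℕ → List ℕ → Bool
permWithDom n t L = does (unique? L) ∧ does (nDom n L ≟ t)

PermWords : ℕ → ℕ → Set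
PermWords n t = Words n n (permWithDom n t)

permWords-card : ∀ n t → Card (PermWords n t) (f1 n t)
permWords-card n t =
  subst (Card (PermWords n t)) (sym (cong length f1-words)) (words-card n n (permWithDom n t))
  where
  encode : ∀ {v} → IsPerm v × numDom1 v ≡ t → T (permWithDom n t (values v))
  encode {v} (perm , dom) = Equivalence.from T-∧
    ( does⁺ (unique? (values v)) (values-unique⁺ v perm)
    , does⁺ (nDom n (values v) ≟ t) (trans (sym (numDom1≡nDom v perm)) dom) )
  decode : ∀ {v} → T (permWithDom n t (values v)) → IsPerm v × numDom1 v ≡ t
  decode {v} test with Equivalence.to T-∧ test
  ... | distinct , dom = perm , trans (numDom1≡nDom v perm) (does⁻ (nDom n (values v) ≟ t) dom)
    where
    perm : IsPerm v
    perm = values-unique⁻ v (does⁻ (unique? (values v)) distinct)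
  f1-words : filter (λ v → isPerm? v ×-dec (numDom1 v ≟ t)) (allVecs n n)
           ≡ filter (T? ∘ permWithDom n t ∘ values) (allVecs n n)
  f1-words = ListP.filter-≐ (λ v → isPerm? v ×-dec (numDom1 v ≟ t)) (T? ∘ permWithDom n t ∘ values)
                            ((λ {v} → encode {v}) , (λ {v} → decode {v})) (allVecs n n)

nDom≤length : ∀ lim L → nDom lim L ≤ length L
nDom≤length lim [] = z≤n
nDom≤length lim (y ∷ ys) = ℕP.+-mono-≤ (indicator≤1 _) (nDom≤length (lim ⊓ y) ys)

nDom-bound : ∀ {m l} ys → All (_< m) ys → m ≤ l → nDom l ys ≡ nDom m ys
nDom-bound [] _ _ = refl
nDom-bound {m} {l} (y ∷ ys) (y<m ∷ _) m≤l =
  cong₂ (λ b k → indicator b + nDom k ys)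
        (does-⇔ (mk⇔ (λ (_ , ys<y) → y<m , ys<y)
                     (λ (_ , ys<y) → ℕP.<-≤-trans y<m m≤l , ys<y))
                (domHead? l y ys) (domHead? m y ys))
        (trans (ℕP.m≥n⇒m⊓n≡n (ℕP.≤-trans (ℕP.<⇒≤ y<m) m≤l))
               (sym (ℕP.m≥n⇒m⊓n≡n (ℕP.<⇒≤ y<m))))

domHead-++ : ∀ lim y xs {zs} → All (_< y) zs →
  does (domHead? lim y (xs ++ zs)) ≡ does (domHead? lim y xs)
domHead-++ lim y xs zs<y =
  does-⇔ (mk⇔ (λ (y<lim , xs<y) → y<lim , All.++⁻ˡ xs xs<y)
              (λ (y<lim , xs<y) → y<lim , All.++⁺ xs<y zs<y))
         (domHead? lim y (xs ++ _)) (domHead? lim y xs)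

nDom-++ : ∀ {m lim} xs {ys} → All (m ≤_) xs → All (_< m) ys → m ≤ lim →
  nDom lim (xs ++ ys) ≡ nDom lim xs + nDom m ys
nDom-++ [] _ ys<m m≤lim = nDom-bound _ ys<m m≤lim
nDom-++ {m} {lim} (x ∷ xs) {ys} (m≤x ∷ m≤xs) ys<m m≤lim = begin
  indicator (does (domHead? lim x (xs ++ ys))) + nDom (lim ⊓ x) (xs ++ ys)
    ≡⟨ cong₂ _+_ (cong indicator (domHead-++ lim x xs (All.map (λ y<m → ℕP.<-≤-trans y<m m≤x) ys<m)))
                 (nDom-++ xs m≤xs ys<m (ℕP.⊓-glb m≤lim m≤x)) ⟩
  indicator (does (domHead? lim x xs)) + (nDom (lim ⊓ x) xs + nDom m ys)
    ≡⟨ ℕP.+-assoc (indicator (does (domHead? lim x xs))) _ _ ⟨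
  nDom lim (x ∷ xs) + nDom m ys ∎

nDom-pivot : ∀ {lim x} P {R} → x < lim → All (x <_) P → All (_< x) R →
  nDom lim (P ++ x ∷ R) ≡ nDom lim P + suc (nDom x R)
nDom-pivot {lim} {x} P {R} x<lim x<P R<x = begin
  nDom lim (P ++ x ∷ R)              ≡⟨ nDom-++ P x<P (ℕP.n<1+n x ∷ All.map ℕP.m<n⇒m<1+n R<x) x<lim ⟩
  nDom lim P + nDom (suc x) (x ∷ R)  ≡⟨ cong (nDom lim P +_) pivot-counts ⟩
  nDom lim P + suc (nDom x R)        ∎
  where
  pivot-counts : nDom (suc x) (x ∷ R) ≡ suc (nDom x R)
  pivot-counts = cong₂ (λ b k → indicator b + nDom k R)
                       (dec-true (domHead? (suc x) x R) (ℕP.n<1+n x , R<x))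
                       (ℕP.m≥n⇒m⊓n≡n (ℕP.n≤1+n x))

nDom-shift : ∀ l c A → nDom (l + c) (map (_+ c) A) ≡ nDom l A
nDom-shift l c [] = refl
nDom-shift l c (x ∷ A) =
  cong₂ (λ b k → indicator b + k)
        (does-⇔ shifted (domHead? (l + c) (x + c) (map (_+ c) A)) (domHead? l x A))
        (trans (cong (λ k → nDom k (map (_+ c) A)) (sym (ℕP.+-distribʳ-⊓ c l x)))
               (nDom-shift (l ⊓ x) c A))
  where
  shifted : DomHead (l + c) (x + c) (map (_+ c) A) ⇔ DomHead l x A
  shifted = mk⇔
    (λ (x<l , A<x) → ℕP.+-cancelʳ-< c x l x<l
                    , All.map (λ {y} → ℕP.+-cancelʳ-< c y x) (All.map⁻ A<x))
    (λ (x<l , A<x) → ℕP.+-monoˡ-< c x<l , All.map⁺ (All.map (ℕP.+-monoˡ-< c) A<x))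

record Cut : Set where
  constructor cut
  field
    prefix : List ℕ
    pivot : ℕ
    suffix : List ℕ
open Cut

consPrefix : ℕ → Cut → Cut
consPrefix y c = cut (y ∷ prefix c) (pivot c) (suffix c)

cutAtFirstDominant : ℕ → List ℕ → Cut
cutAtFirstDominant lim [] = cut [] 0 []
cutAtFirstDominant lim (y ∷ ys) with domHead? lim y ys
... | yes _ = cut [] y ys
... | no _ = consPrefix y (cutAtFirstDominant (lim ⊓ y) ys)

record FirstDominant (lim : ℕ) (L : List ℕ) (c : Cut) : Set where
  field
    splits : L ≡ prefix c ++ pivot c ∷ suffix c
    pivot<lim : pivot c < lim
    prefix-above : All (pivot c <_) (prefix c)
    suffix-below : All (_< pivot c) (suffix c)
    prefix-none : nDom lim (prefix c) ≡ 0

firstDominant-∷ : ∀ {lim y ys} c → ¬ DomHead lim y ys →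
  FirstDominant (lim ⊓ y) ys c → FirstDominant lim (y ∷ ys) (consPrefix y c)
firstDominant-∷ {lim} {y} {ys} c ¬head fd = record
  { splits = cong (y ∷_) splits
  ; pivot<lim = ℕP.m<n⊓o⇒m<n lim y pivot<lim
  ; prefix-above = x<y ∷ prefix-above
  ; suffix-below = suffix-below
  ; prefix-none = cong₂ (λ b k → indicator b + k) y-not-dominant prefix-none
  }
  where
  open FirstDominant fd
  x<y : pivot c < y
  x<y = ℕP.m<n⊓o⇒m<o lim y pivot<lim
  y-not-dominant : does (domHead? lim y (prefix c)) ≡ false
  y-not-dominant = begin
    does (domHead? lim y (prefix c))
      ≡⟨ domHead-++ lim y (prefix c) (x<y ∷ All.map (λ z<x → ℕP.<-trans z<x x<y) suffix-below) ⟨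
    does (domHead? lim y (prefix c ++ pivot c ∷ suffix c))
      ≡⟨ cong (does ∘ domHead? lim y) splits ⟨
    does (domHead? lim y ys)
      ≡⟨ dec-false (domHead? lim y ys) ¬head ⟩
    false ∎

cut-firstDominant : ∀ lim L → 0 < nDom lim L → FirstDominant lim L (cutAtFirstDominant lim L)
cut-firstDominant lim [] ()
cut-firstDominant lim (y ∷ ys) pos with domHead? lim y ys
... | yes (y<lim , ys<y) = record
  { splits = refl ; pivot<lim = y<lim ; prefix-above = [] ; suffix-below = ys<y ; prefix-none = refl }
... | no ¬head = firstDominant-∷ _ ¬head (cut-firstDominant (lim ⊓ y) ys pos′)
  where
  pos′ : 0 < nDom (lim ⊓ y) ys
  pos′ = subst (λ b → 0 < indicator b + nDom (lim ⊓ y) ys) (dec-false (domHead? lim y ys) ¬head) pos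

cut-pivot : ∀ {lim} P x R → x < lim → All (x <_) P → All (_< x) R → nDom lim P ≡ 0 →
  cutAtFirstDominant lim (P ++ x ∷ R) ≡ cut P x R
cut-pivot {lim} [] x R x<lim _ R<x _ with domHead? lim x R
... | yes _ = refl
... | no ¬head = ⊥-elim (¬head (x<lim , R<x))
cut-pivot {lim} (y ∷ P) x R x<lim (x<y ∷ x<P) R<x none with domHead? lim y (P ++ x ∷ R)
... | yes (y<lim , rest<y) =
  ⊥-elim (ℕP.1+n≢0 (trans (cong indicator (sym (dec-true (domHead? lim y P)
                                                          (y<lim , All.++⁻ˡ P rest<y))))
                          (ℕP.m+n≡0⇒m≡0 _ none)))
... | no _ =
  cong (consPrefix y) (cut-pivot P x R (ℕP.⊓-glb x<lim x<y) x<P R<x (ℕP.m+n≡0⇒n≡0 _ none))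

record IsPermWord (n t : ℕ) (L : List ℕ) : Set where
  field
    distinct : Unique L
    bounded : All (_< n) L
    size : length L ≡ n
    dominants : nDom n L ≡ t

packPermWord : ∀ {n t L} → IsPermWord n t L → PermWords n t
packPermWord {n} {t} {L} w =
  L , (bounded , size)
    , Equivalence.from T-∧ (does⁺ (unique? L) distinct , does⁺ (nDom n L ≟ t) dominants)
  where open IsPermWord w

unpackPermWord : ∀ {n t} (w : PermWords n t) → IsPermWord n t (proj₁ w)
unpackPermWord {n} {t} (L , (bounded , size) , test) = record
  { distinct = does⁻ (unique? L) (proj₁ (Equivalence.to T-∧ test))
  ; bounded = bounded
  ; size = size
  ; dominants = does⁻ (nDom n L ≟ t) (proj₂ (Equivalence.to T-∧ test))
  }

unique-++⁻ : ∀ (xs : List ℕ) {ys} → Unique (xs ++ ys) → Unique xs × Unique ys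
unique-++⁻ [] u = [] , u
unique-++⁻ (x ∷ xs) (x∉ ∷ u) = (All.++⁻ˡ xs x∉ ∷ proj₁ (unique-++⁻ xs u)) , proj₂ (unique-++⁻ xs u)

unique-lookup-injective : ∀ {L : List ℕ} → Unique L →
  ∀ i j → List.lookup L i ≡ List.lookup L j → i ≡ j
unique-lookup-injective {_ ∷ _} _ zero zero _ = refl
unique-lookup-injective {_ ∷ _} (x∉ ∷ _) zero (suc j) e = ⊥-elim (All.lookup x∉ (∈-lookup j) e)
unique-lookup-injective {_ ∷ _} (x∉ ∷ _) (suc i) zero e = ⊥-elim (All.lookup x∉ (∈-lookup i) (sym e))
unique-lookup-injective {_ ∷ _} (_ ∷ u) (suc i) (suc j) e = cong suc (unique-lookup-injective u i j e)

unique-length≤ : ∀ {m L} → Unique L → All (_< m) L → length L ≤ m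
unique-length≤ {m} {L} distinct bounded = FinP.injective⇒≤ {f = position} position-injective
  where
  position : Fin (length L) → Fin m
  position i = fromℕ< (All.lookup bounded (∈-lookup i))
  position-injective : ∀ {i j} → position i ≡ position j → i ≡ j
  position-injective {i} {j} e = unique-lookup-injective distinct i j
    (trans (sym (FinP.toℕ-fromℕ< _)) (trans (cong toℕ e) (FinP.toℕ-fromℕ< _)))

shift-unshift : ∀ c xs → All (c ≤_) xs → map (_+ c) (map (_∸ c) xs) ≡ xs
shift-unshift c [] [] = refl
shift-unshift c (x ∷ xs) (c≤x ∷ c≤xs) = cong₂ _∷_ (ℕP.m∸n+n≡m c≤x) (shift-unshift c xs c≤xs)

unshift-shift : ∀ c xs → map (_∸ c) (map (_+ c) xs) ≡ xs
unshift-shift c [] = refl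
unshift-shift c (x ∷ xs) = cong₂ _∷_ (ℕP.m+n∸n≡m x c) (unshift-shift c xs)

glue : ℕ → List ℕ → List ℕ → List ℕ
glue b A B = map (_+ suc b) A ++ b ∷ B

glue-perm : ∀ {a b r s A B} → IsPermWord a r A → IsPermWord b s B →
  IsPermWord (a + suc b) (r + suc s) (glue b A B)
glue-perm {a} {b} {r} {s} {A} {B} wA wB = record
  { distinct = AllPairs.++⁺ (Unique.map⁺ (λ {x} {y} → ℕP.+-cancelʳ-≡ (suc b) x y) A.distinct)
                            (All.map (λ z<b b≡z → ℕP.<-irrefl (sym b≡z) z<b) B.bounded ∷ B.distinct)
                            (All.map⁺ (All.universal separated A))
  ; bounded = All.++⁺ (All.map⁺ (All.map (ℕP.+-monoˡ-< (suc b)) A.bounded))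
                      (b<n ∷ All.map (λ z<b → ℕP.<-trans z<b b<n) B.bounded)
  ; size = trans (ListP.length-++ (map (_+ suc b) A))
                 (cong₂ (λ p q → p + suc q) (trans (ListP.length-map _ A) A.size) B.size)
  ; dominants = begin
      nDom (a + suc b) (glue b A B)
        ≡⟨ nDom-pivot (map (_+ suc b) A) b<n shifted-above B.bounded ⟩
      nDom (a + suc b) (map (_+ suc b) A) + suc (nDom b B)
        ≡⟨ cong₂ (λ p q → p + suc q) (trans (nDom-shift a (suc b) A) A.dominants) B.dominants ⟩
      r + suc s ∎
  }
  where
  module A = IsPermWord wA
  module B = IsPermWord wB
  b<n : b < a + suc b
  b<n = ℕP.m≤n+m (suc b) a
  shifted-above : All (b <_) (map (_+ suc b) A)
  shifted-above = All.map⁺ (All.universal (λ z → ℕP.m≤n+m (suc b) z) A)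
  separated : ∀ z → All (z + suc b ≢_) (b ∷ B)
  separated z = (λ e → ℕP.<-irrefl (sym e) (ℕP.m≤n+m (suc b) z))
              ∷ All.map (λ y<b e → ℕP.<-irrefl (sym e) (ℕP.<-trans y<b (ℕP.m≤n+m (suc b) z))) B.bounded

cut-glue : ∀ {a b A B} → All (_< a) A → All (_< b) B → nDom a A ≡ 0 →
  cutAtFirstDominant (a + suc b) (glue b A B) ≡ cut (map (_+ suc b) A) b B
cut-glue {a} {b} {A} {B} A<a B<b none =
  cut-pivot (map (_+ suc b) A) b B (ℕP.m≤n+m (suc b) a)
            (All.map⁺ (All.universal (λ z → ℕP.m≤n+m (suc b) z) A)) B<b
            (trans (nDom-shift a (suc b) A) none)

pieces-fit : ∀ {p r x n} → p + suc r ≡ n → p ≤ n ∸ suc x → r ≤ x → x < n → r ≡ x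
pieces-fit {p} {r} {x} {n} total p≤ r≤x x<n =
  ℕP.≤-antisym r≤x (ℕP.≤-pred (ℕP.+-cancelˡ-≤ p (suc x) (suc r) p+x<n))
  where
  p+x<n : p + suc x ≤ p + suc r
  p+x<n = ℕP.≤-trans (ℕP.+-monoˡ-≤ (suc x) p≤) (ℕP.≤-reflexive (trans (ℕP.m∸n+n≡m x<n) (sym total)))

module Unglue {n s L c} (w : IsPermWord n (suc s) L) (fd : FirstDominant n L c) where
  open IsPermWord w
  open FirstDominant fd

  a : ℕ
  a = length (prefix c)

  lowered : List ℕ
  lowered = map (_∸ suc (pivot c)) (prefix c)

  private
    x : ℕ
    x = pivot c
    P R : List ℕ
    P = prefix c
    R = suffix c

    pieces-size : a + suc (length R) ≡ n
    pieces-size = trans (sym (ListP.length-++ P)) (trans (cong length (sym splits)) size)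

    distinct-pieces : Unique P × Unique (x ∷ R)
    distinct-pieces = unique-++⁻ P (subst Unique splits distinct)

    R-distinct : Unique R
    R-distinct with proj₂ distinct-pieces
    ... | _ ∷ u = u

    lowered-distinct : Unique lowered
    lowered-distinct = Unique.map⁻ (subst Unique (sym (shift-unshift (suc x) P prefix-above))
                                          (proj₁ distinct-pieces))

    lowered-bounded : All (_< n ∸ suc x) lowered
    lowered-bounded = All.map⁺ (All.zipWith (λ (y<n , x<y) → ℕP.∸-monoˡ-< y<n x<y)
                                            (All.++⁻ˡ P (subst (All (_< n)) splits bounded) , prefix-above))

    -- The pieces fill the word; the pigeonhole bounds |P| ≤ n-1-x and |R| ≤ x are attained.
    R-size : length R ≡ x
    R-size = pieces-fit pieces-size
                        (subst (_≤ n ∸ suc x) (ListP.length-map _ P)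
                               (unique-length≤ lowered-distinct lowered-bounded))
                        (unique-length≤ R-distinct suffix-below) pivot<lim

    fits : a + suc x ≡ n
    fits = trans (cong (λ r → a + suc r) (sym R-size)) pieces-size

    pivot≡ : x ≡ n ∸ suc a
    pivot≡ = sym (trans (cong (_∸ suc a) (trans (sym fits) (ℕP.+-suc a x))) (ℕP.m+n∸m≡n (suc a) x))

    R-dominants : nDom x R ≡ s
    R-dominants = ℕP.suc-injective (begin
      suc (nDom x R)                   ≡⟨ cong (_+ suc (nDom x R)) prefix-none ⟨
      nDom n P + suc (nDom x R)        ≡⟨ nDom-pivot P pivot<lim prefix-above suffix-below ⟨
      nDom n (P ++ x ∷ R)              ≡⟨ cong (nDom n) splits ⟨
      nDom n L                         ≡⟨ dominants ⟩
      suc s                            ∎)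

  suffix-word : IsPermWord (n ∸ suc a) s (suffix c)
  suffix-word = subst (λ m → IsPermWord m s R) pivot≡ record
    { distinct = R-distinct ; bounded = suffix-below ; size = R-size ; dominants = R-dominants }

  prefix-word : IsPermWord a 0 lowered
  prefix-word = record
    { distinct = lowered-distinct
    ; bounded = subst (λ m → All (_< m) lowered)
                      (trans (cong (_∸ suc x) (sym fits)) (ℕP.m+n∸n≡m a (suc x))) lowered-bounded
    ; size = ListP.length-map _ P
    ; dominants = begin
        nDom a lowered
          ≡⟨ nDom-shift a (suc x) lowered ⟨
        nDom (a + suc x) (map (_+ suc x) lowered)
          ≡⟨ cong₂ nDom fits (shift-unshift (suc x) P prefix-above) ⟩
        nDom n P
          ≡⟨ prefix-none ⟩
        0 ∎
    }

  -- The prefix has at most n - 1 - s entries, since the suffix holds s dominant entries.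
  a<n∸s : a < n ∸ s
  a<n∸s = ℕP.m+n≤o⇒m≤o∸n (suc a)
    (ℕP.≤-trans (ℕP.+-monoʳ-≤ (suc a) s≤x) (ℕP.≤-reflexive (trans (sym (ℕP.+-suc a x)) fits)))
    where
    s≤x : s ≤ x
    s≤x = ℕP.≤-trans (ℕP.≤-reflexive (sym R-dominants))
                     (ℕP.≤-trans (nDom≤length x R) (ℕP.≤-reflexive R-size))

  reglue : glue (n ∸ suc a) lowered R ≡ L
  reglue = begin
    glue (n ∸ suc a) lowered R  ≡⟨ cong (λ b → glue b lowered R) pivot≡ ⟨
    glue x lowered R            ≡⟨ cong (_++ x ∷ R) (shift-unshift (suc x) P prefix-above) ⟩
    P ++ x ∷ R                  ≡⟨ splits ⟨
    L                           ∎

Pieces : ℕ → ℕ → Set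
Pieces n s = Σ ℕ (λ a → a < n ∸ s × (PermWords (n ∸ suc a) s × PermWords a 0))

decompose : ∀ n s → PermWords n (suc s) ↔ Pieces n s
decompose n s = mk↔ₛ′ split join split∘join join∘split
  where
  firstDominant : (w : PermWords n (suc s)) →
    FirstDominant n (proj₁ w) (cutAtFirstDominant n (proj₁ w))
  firstDominant w = cut-firstDominant n (proj₁ w)
    (subst (0 <_) (sym (IsPermWord.dominants (unpackPermWord w))) (s≤s z≤n))

  split : PermWords n (suc s) → Pieces n s
  split w = a , a<n∸s , packPermWord suffix-word , packPermWord prefix-word
    where open Unglue (unpackPermWord w) (firstDominant w)

  fill : ∀ {a} → a < n ∸ s → a + suc (n ∸ suc a) ≡ n
  fill {a} a<n∸s =
    trans (ℕP.+-suc a (n ∸ suc a)) (ℕP.m+[n∸m]≡n (ℕP.<-≤-trans a<n∸s (ℕP.m∸n≤m n s)))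

  join : Pieces n s → PermWords n (suc s)
  join (a , a<n∸s , B , A) = packPermWord
    (subst (λ m → IsPermWord m (suc s) (glue (n ∸ suc a) (proj₁ A) (proj₁ B))) (fill a<n∸s)
           (glue-perm (unpackPermWord A) (unpackPermWord B)))

  pieces-≡ : ∀ {a a'} {a< : a < n ∸ s} {a<' : a' < n ∸ s}
    {B : PermWords (n ∸ suc a) s} {B' : PermWords (n ∸ suc a') s}
    {A : PermWords a 0} {A' : PermWords a' 0} →
    a ≡ a' → proj₁ B ≡ proj₁ B' → proj₁ A ≡ proj₁ A' →
    _≡_ {A = Pieces n s} (a , a< , B , A) (a' , a<' , B' , A')
  pieces-≡ refl eB eA =
    cong₂ (λ p q → _ , p , q) (ℕP.≤-irrelevant _ _) (cong₂ _,_ (words-≡ eB) (words-≡ eA))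

  split∘join : ∀ z → split (join z) ≡ z
  split∘join (a , a<n∸s , B , A) = pieces-≡
    (trans (cong (length ∘ prefix) cut≡) (trans (ListP.length-map _ (proj₁ A)) (IsPermWord.size wA)))
    (cong suffix cut≡)
    (trans (cong (λ c → map (_∸ suc (pivot c)) (prefix c)) cut≡) (unshift-shift (suc b) (proj₁ A)))
    where
    b = n ∸ suc a
    wA = unpackPermWord A
    wB = unpackPermWord B
    cut≡ : cutAtFirstDominant n (glue b (proj₁ A) (proj₁ B)) ≡ cut (map (_+ suc b) (proj₁ A)) b (proj₁ B)
    cut≡ = subst (λ m → cutAtFirstDominant m (glue b (proj₁ A) (proj₁ B))
                          ≡ cut (map (_+ suc b) (proj₁ A)) b (proj₁ B))
                 (fill a<n∸s)
                 (cut-glue (IsPermWord.bounded wA) (IsPermWord.bounded wB) (IsPermWord.dominants wA))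

  join∘split : ∀ w → join (split w) ≡ w
  join∘split w = words-≡ reglue
    where open Unglue (unpackPermWord w) (firstDominant w)

decompose-card : ∀ n s →
  Card (PermWords n (suc s)) (sum (applyUpTo (λ a → f1 (n ∸ suc a) s * f1 a 0) (n ∸ s)))
decompose-card n s = ↔-trans
  (card-Σ< (n ∸ s) _ _ (λ a → card-× (permWords-card (n ∸ suc a) s) (permWords-card a 0)))
  (↔-sym (decompose n s))

∸-suc-+1 : ∀ {n s} → s < n → n ∸ suc s + 1 ≡ n ∸ s
∸-suc-+1 {suc n} {s} (s≤s s≤n) = trans (ℕP.+-comm (n ∸ s) 1) (sym (ℕP.+-∸-assoc 1 s≤n))

theorem2 : (n t : ℕ) → 1 ≤ n → 1 ≤ t → t ≤ n →
    f1 n t ≡ sumFromTo 1 (n ∸ t + 1) (λ k → f1 (n ∸ k) (t ∸ 1) * f1 (k ∸ 1) 0)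
theorem2 n zero _ () _
theorem2 n (suc s) _ _ s<n = begin
  f1 n (suc s)
    ≡⟨ card-unique (permWords-card n (suc s)) (decompose-card n s) ⟩
  sum (applyUpTo term (n ∸ s))
    ≡⟨ cong (sum ∘ applyUpTo term) (∸-suc-+1 s<n) ⟨
  sum (applyUpTo term (n ∸ suc s + 1))
    ≡⟨ cong sum (ListP.map-upTo term (n ∸ suc s + 1)) ⟨
  sum (map term (upTo (n ∸ suc s + 1))) ∎
  where
  -- The summand for k = a + 1; the last sum is sumFromTo 1 (n ∸ t + 1) … by definition.
  term : ℕ → ℕ
  term a = f1 (n ∸ suc a) s * f1 a 0
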